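{- Let $\mathcal{H}$ be an $r$-uniform hypergraph on $n$ vertices. Then $|\mathcal{H}|\geq \frac{n}{r^2}\,\sigma_r(\mathcal{H})$, with equality only if $\mathcal{H}$ is regular.
   Context: An $r$-uniform hypergraph on an $n$-element vertex set $V$ is a family of $r$-subsets of $V$ (its edges); $|\mathcal{H}|$ is its number of edges. The degree $\deg(v)$ of a vertex is the number of edges containing it; for an $r$-set $S$, $\deg(S)=\sum_{v\in S}\deg(v)$. The Ore-degree $\sigma_r(\mathcal{H})$ is the minimum of $\deg(S)$ over all $r$-subsets $S\subseteq V$ that are not edges of $\mathcal{H}$ (so it is defined when such a non-edge exists). $\mathcal{H}$ is regular if all vertex degrees are equal. -}

module Defs where

open import Data.Nat using (ℕ; zero; suc; _+_; _≤_)
open import Data.Bool using (Bool; true; false)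
open import Data.List using (List; []; _∷_; [_]; map; _++_; filter)
open import Data.Nat.ListAction using (sum)
open import Data.Bool using (_∧_)
open import Relation.Nullary.Decidable using (⌊_⌋)
open import Data.Fin using (Fin)
open import Data.Fin.Subset using (Subset; inside; outside; ∣_∣)
open import Data.Fin.Subset.Properties using (_∈?_)
open import Data.List using (allFin)
open import Data.Vec using (_∷_; [])
open import Data.Product using (Σ; _×_)
open import Relation.Binary.PropositionalEquality using (_≡_)

subsets : (n : ℕ) → List (Subset n)
subsets zero    = [ [] ]
subsets (suc n) = map (outside ∷_) (subsets n) ++ map (inside ∷_) (subsets n)

countB : {A : Set} → (A → Bool) → List A → ℕ
countB p []       = 0
countB p (x ∷ xs) with p x
... | true  = suc (countB p xs)
... | false = countB p xs

Hypergraph : ℕ → Set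
Hypergraph n = Subset n → Bool

IsEdge : ∀ {n} → Hypergraph n → Subset n → Set
IsEdge H S = H S ≡ true

Uniform : ∀ {n} → ℕ → Hypergraph n → Set
Uniform r H = ∀ S → IsEdge H S → ∣ S ∣ ≡ r

size : ∀ {n} → Hypergraph n → ℕ
size {n} H = countB H (subsets n)

deg : ∀ {n} → Hypergraph n → Fin n → ℕ
deg {n} H v = countB (λ S → H S ∧ ⌊ v ∈? S ⌋) (subsets n)

degSet : ∀ {n} → Hypergraph n → Subset n → ℕ
degSet {n} H S = sum (map (deg H) (filter (_∈? S) (allFin n)))

-- s is the Ore-degree σ_r(H): the minimum of deg(S) over r-subsets S that are
-- not edges (in particular such a non-edge exists).
IsOreDegree : ∀ {n} → ℕ → Hypergraph n → ℕ → Set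
IsOreDegree {n} r H s =
  Σ (Subset n) (λ S → ∣ S ∣ ≡ r × H S ≡ false × degSet H S ≡ s)
  × (∀ S → ∣ S ∣ ≡ r → H S ≡ false → s ≤ degSet H S)

Regular : ∀ {n} → Hypergraph n → Set
Regular H = ∀ u v → deg H u ≡ deg H v

-- Let m = |H|, let K be the number of r-sets that are not edges and P the sum of deg(S) over them.
-- Summing deg(S) over the edges gives Q = Σ_v deg(v)², and summing it over all r-sets gives
-- Σ_v c · deg(v), where c is the number of r-sets through a vertex: the same for every vertex, with
-- n c = r (m + K).  Hence n (Q + P) = r (m + K) · r m.  Cauchy–Schwarz gives (r m)² ≤ n Q, so
-- n P ≤ r² m K, while P ≥ σ_r K by the definition of σ_r; as K ≥ 1 this gives n σ_r ≤ r² m.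
-- Equality forces equality in Cauchy–Schwarz, i.e. all degrees are equal.
module Submission where

open import Data.Bool using (Bool; true; false; _∧_; not)
open import Data.Bool.Properties using (∧-identityʳ; ∧-zeroʳ; T-≡)
open import Data.Fin using (Fin; zero; suc)
open import Data.Fin.Subset using (Subset; inside; outside; ∣_∣)
open import Data.Fin.Subset.Properties using (_∈?_; x∈p⇒∣p-x∣<∣p∣)
open import Data.List using (List; []; _∷_; map; _++_; length; filter; allFin)
open import Data.List.Membership.Propositional using (_∈_)
open import Data.List.Membership.Propositional.Properties using (∈-++⁺ˡ; ∈-++⁺ʳ; ∈-map⁺; ∈-allFin)
open import Data.List.Properties using (map-tabulate; length-tabulate)
open import Data.List.Relation.Unary.Any using (here; there)
open import Data.Nat
open import Data.Nat.ListAction using (sum)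
open import Data.Nat.Properties
open import Data.Nat.Tactic.RingSolver using (solve-∀)
open import Data.Product using (_×_; _,_; proj₁; proj₂; map₂)
open import Data.Sum using ([_,_]′)
open import Data.Vec using (_∷_; [])
open import Function using (id; Equivalence)
open import Relation.Binary.PropositionalEquality using (_≡_; refl; sym; trans; cong; cong₂; subst; subst₂; module ≡-Reasoning)
open import Relation.Nullary.Decidable using (⌊_⌋; Dec; yes; no)
open import Relation.Nullary.Negation using (contradiction)

open import Defs

open ≡-Reasoning

∑ : {A : Set} → List A → (A → ℕ) → ℕ
∑ []       f = 0
∑ (x ∷ xs) f = f x + ∑ xs f

syntax ∑ xs (λ x → e) = ∑[ x ∈ xs ] e

module _ {A : Set} where

  ∑-cong : (xs : List A) {f g : A → ℕ} → (∀ x → f x ≡ g x) → ∑ xs f ≡ ∑ xs g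
  ∑-cong []       e = refl
  ∑-cong (x ∷ xs) e = cong₂ _+_ (e x) (∑-cong xs e)

  ∑-distrib-+ : (xs : List A) (f g : A → ℕ) → ∑[ x ∈ xs ] (f x + g x) ≡ ∑ xs f + ∑ xs g
  ∑-distrib-+ []       f g = refl
  ∑-distrib-+ (x ∷ xs) f g = begin
    f x + g x + ∑[ y ∈ xs ] (f y + g y) ≡⟨ cong (f x + g x +_) (∑-distrib-+ xs f g) ⟩
    f x + g x + (∑ xs f + ∑ xs g)       ≡⟨ +-interchange (f x) (g x) _ _ ⟩
    f x + ∑ xs f + (g x + ∑ xs g)       ∎
    where +-interchange : ∀ a b c d → a + b + (c + d) ≡ a + c + (b + d)
          +-interchange = solve-∀

  ∑-distribˡ-* : (xs : List A) (a : ℕ) (f : A → ℕ) → ∑[ x ∈ xs ] (a * f x) ≡ a * ∑ xs f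
  ∑-distribˡ-* []       a f = sym (*-zeroʳ a)
  ∑-distribˡ-* (x ∷ xs) a f =
    trans (cong (a * f x +_) (∑-distribˡ-* xs a f)) (sym (*-distribˡ-+ a (f x) (∑ xs f)))

  ∑-distribʳ-* : (xs : List A) (a : ℕ) (f : A → ℕ) → ∑[ x ∈ xs ] (f x * a) ≡ ∑ xs f * a
  ∑-distribʳ-* xs a f = begin
    ∑[ x ∈ xs ] (f x * a) ≡⟨ ∑-cong xs (λ x → *-comm (f x) a) ⟩
    ∑[ x ∈ xs ] (a * f x) ≡⟨ ∑-distribˡ-* xs a f ⟩
    a * ∑ xs f            ≡⟨ *-comm a _ ⟩
    ∑ xs f * a            ∎

  ∑-const : (xs : List A) (a : ℕ) → ∑[ _ ∈ xs ] a ≡ length xs * a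
  ∑-const []       a = refl
  ∑-const (x ∷ xs) a = cong (a +_) (∑-const xs a)

  ∑-zero : (xs : List A) {f : A → ℕ} → (∀ x → f x ≡ 0) → ∑ xs f ≡ 0
  ∑-zero xs e = trans (∑-cong xs e) (trans (∑-const xs 0) (*-zeroʳ (length xs)))

  ∑-++ : (xs ys : List A) (f : A → ℕ) → ∑ (xs ++ ys) f ≡ ∑ xs f + ∑ ys f
  ∑-++ []       ys f = refl
  ∑-++ (x ∷ xs) ys f = trans (cong (f x +_) (∑-++ xs ys f)) (sym (+-assoc (f x) _ _))

  ∑-map : {B : Set} (xs : List B) (g : B → A) (f : A → ℕ) → ∑ (map g xs) f ≡ ∑[ x ∈ xs ] f (g x)
  ∑-map []       g f = refl
  ∑-map (x ∷ xs) g f = cong (f (g x) +_) (∑-map xs g f)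

  ∑-mono-≤ : (xs : List A) {f g : A → ℕ} → (∀ x → f x ≤ g x) → ∑ xs f ≤ ∑ xs g
  ∑-mono-≤ []       e = z≤n
  ∑-mono-≤ (x ∷ xs) e = +-mono-≤ (e x) (∑-mono-≤ xs e)

  ∈⇒≤∑ : {xs : List A} (f : A → ℕ) {x : A} → x ∈ xs → f x ≤ ∑ xs f
  ∈⇒≤∑ {y ∷ ys} f (here refl) = m≤m+n (f y) (∑ ys f)
  ∈⇒≤∑ {y ∷ ys} f (there x∈ys) = ≤-trans (∈⇒≤∑ f x∈ys) (m≤n+m (∑ ys f) (f y))

  constant⇒length*∑f*g≡∑f*∑g : (xs : List A) (f g : A → ℕ) → (∀ x y → f x ≡ f y) →
    length xs * ∑[ x ∈ xs ] (f x * g x) ≡ ∑ xs f * ∑ xs g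
  constant⇒length*∑f*g≡∑f*∑g xs f g f-const = begin
    length xs * ∑[ x ∈ xs ] (f x * g x)   ≡⟨ ∑-const xs _ ⟨
    ∑[ y ∈ xs ] ∑[ x ∈ xs ] (f x * g x)   ≡⟨ ∑-cong xs (λ y → ∑-cong xs (λ x → cong (_* g x) (f-const x y))) ⟩
    ∑[ y ∈ xs ] ∑[ x ∈ xs ] (f y * g x)   ≡⟨ ∑-cong xs (λ y → ∑-distribˡ-* xs (f y) g) ⟩
    ∑[ y ∈ xs ] (f y * ∑ xs g)            ≡⟨ ∑-distribʳ-* xs (∑ xs g) f ⟩
    ∑ xs f * ∑ xs g                       ∎

∑-swap : {A B : Set} (xs : List A) (ys : List B) (f : A → B → ℕ) →
         ∑[ x ∈ xs ] ∑[ y ∈ ys ] f x y ≡ ∑[ y ∈ ys ] ∑[ x ∈ xs ] f x y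
∑-swap []       ys f = sym (∑-zero ys (λ _ → refl))
∑-swap (x ∷ xs) ys f =
  trans (cong (∑ ys (f x) +_) (∑-swap xs ys f)) (sym (∑-distrib-+ ys (f x) _))

a*a+b*b≡2ab+∣a-b∣² : ∀ a b → a * a + b * b ≡ 2 * (a * b) + ∣ a - b ∣ * ∣ a - b ∣
a*a+b*b≡2ab+∣a-b∣² a b = [ ordered , swapped ]′ (≤-total a b)
  where
  ordered : ∀ {a b} → a ≤ b → a * a + b * b ≡ 2 * (a * b) + ∣ a - b ∣ * ∣ a - b ∣
  ordered {a} {b} a≤b = begin
    a * a + b * b                        ≡⟨ cong (λ t → a * a + t * t) (m+[n∸m]≡n a≤b) ⟨
    a * a + (a + k) * (a + k)            ≡⟨ expand a k ⟩
    2 * (a * (a + k)) + k * k            ≡⟨ cong₂ (λ t u → 2 * (a * t) + u * u) (m+[n∸m]≡n a≤b) (sym (m≤n⇒∣m-n∣≡n∸m a≤b)) ⟩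
    2 * (a * b) + ∣ a - b ∣ * ∣ a - b ∣  ∎
    where k = b ∸ a
          expand : ∀ a k → a * a + (a + k) * (a + k) ≡ 2 * (a * (a + k)) + k * k
          expand = solve-∀

  swapped : b ≤ a → a * a + b * b ≡ 2 * (a * b) + ∣ a - b ∣ * ∣ a - b ∣
  swapped b≤a = begin
    a * a + b * b                        ≡⟨ +-comm (a * a) (b * b) ⟩
    b * b + a * a                        ≡⟨ ordered b≤a ⟩
    2 * (b * a) + ∣ b - a ∣ * ∣ b - a ∣  ≡⟨ cong₂ (λ t u → 2 * t + u * u) (*-comm b a) (∣-∣-comm b a) ⟩
    2 * (a * b) + ∣ a - b ∣ * ∣ a - b ∣  ∎

module CauchySchwarz {A : Set} (xs : List A) (f : A → ℕ) where

  private
    L = length xs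
    X = ∑ xs f
    Q = ∑[ x ∈ xs ] (f x * f x)
    Δ = ∑[ x ∈ xs ] ∑[ y ∈ xs ] (∣ f x - f y ∣ * ∣ f x - f y ∣)

  lagrange-identity : 2 * (L * Q) ≡ 2 * (X * X) + Δ
  lagrange-identity = begin
    2 * (L * Q)                                    ≡⟨ cong (L * Q +_) (+-identityʳ (L * Q)) ⟩
    L * Q + L * Q                                  ≡⟨ cong₂ _+_ (∑-distribˡ-* xs L _) (∑-const xs Q) ⟨
    ∑[ x ∈ xs ] (L * (f x * f x)) + ∑[ _ ∈ xs ] Q  ≡⟨ ∑-distrib-+ xs _ _ ⟨
    ∑[ x ∈ xs ] (L * (f x * f x) + Q)              ≡⟨ ∑-cong xs (λ x → cong (_+ Q) (∑-const xs (f x * f x))) ⟨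
    ∑[ x ∈ xs ] (∑[ _ ∈ xs ] (f x * f x) + Q)      ≡⟨ ∑-cong xs (λ x → ∑-distrib-+ xs _ _) ⟨
    ∑[ x ∈ xs ] ∑[ y ∈ xs ] (f x * f x + f y * f y)
      ≡⟨ ∑-cong xs (λ x → ∑-cong xs (λ y → a*a+b*b≡2ab+∣a-b∣² (f x) (f y))) ⟩
    ∑[ x ∈ xs ] ∑[ y ∈ xs ] (2 * (f x * f y) + ∣ f x - f y ∣ * ∣ f x - f y ∣)
      ≡⟨ ∑-cong xs (λ x → ∑-distrib-+ xs _ _) ⟩
    ∑[ x ∈ xs ] (∑[ y ∈ xs ] (2 * (f x * f y)) + ∑[ y ∈ xs ] (∣ f x - f y ∣ * ∣ f x - f y ∣))
      ≡⟨ ∑-distrib-+ xs _ _ ⟩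
    ∑[ x ∈ xs ] ∑[ y ∈ xs ] (2 * (f x * f y)) + Δ  ≡⟨ cong (_+ Δ) products ⟩
    2 * (X * X) + Δ                                ∎
    where
    products : ∑[ x ∈ xs ] ∑[ y ∈ xs ] (2 * (f x * f y)) ≡ 2 * (X * X)
    products = begin
      ∑[ x ∈ xs ] ∑[ y ∈ xs ] (2 * (f x * f y))  ≡⟨ ∑-cong xs (λ x → ∑-cong xs (λ y → *-assoc 2 (f x) (f y))) ⟨
      ∑[ x ∈ xs ] ∑[ y ∈ xs ] (2 * f x * f y)    ≡⟨ ∑-cong xs (λ x → ∑-distribˡ-* xs (2 * f x) f) ⟩
      ∑[ x ∈ xs ] (2 * f x * X)                  ≡⟨ ∑-distribʳ-* xs X (λ x → 2 * f x) ⟩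
      ∑[ x ∈ xs ] (2 * f x) * X                  ≡⟨ cong (_* X) (∑-distribˡ-* xs 2 f) ⟩
      2 * X * X                                  ≡⟨ *-assoc 2 X X ⟩
      2 * (X * X)                                ∎

  cauchy-schwarz : X * X ≤ L * Q
  cauchy-schwarz = *-cancelˡ-≤ 2 (≤-trans (m≤m+n (2 * (X * X)) Δ) (≤-reflexive (sym lagrange-identity)))

  cauchy-schwarz-equality : L * Q ≡ X * X → ∀ {x y} → x ∈ xs → y ∈ xs → f x ≡ f y
  cauchy-schwarz-equality LQ≡XX {x} {y} x∈xs y∈xs =
    ∣m-n∣≡0⇒m≡n ([ id , id ]′ (m*n≡0⇒m≡0∨n≡0 _ (n≤0⇒n≡0 distance≤Δ)))
    where
    Δ≡0 : Δ ≡ 0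
    Δ≡0 = +-cancelˡ-≡ (2 * (X * X)) Δ 0 (begin
      2 * (X * X) + Δ  ≡⟨ lagrange-identity ⟨
      2 * (L * Q)      ≡⟨ cong (2 *_) LQ≡XX ⟩
      2 * (X * X)      ≡⟨ +-identityʳ _ ⟨
      2 * (X * X) + 0  ∎)
    distance≤Δ : ∣ f x - f y ∣ * ∣ f x - f y ∣ ≤ 0
    distance≤Δ = ≤-trans (∈⇒≤∑ (λ y′ → ∣ f x - f y′ ∣ * ∣ f x - f y′ ∣) y∈xs)
                 (≤-trans (∈⇒≤∑ (λ x′ → ∑[ y′ ∈ xs ] (∣ f x′ - f y′ ∣ * ∣ f x′ - f y′ ∣)) x∈xs)
                          (≤-reflexive Δ≡0))

open CauchySchwarz using (cauchy-schwarz; cauchy-schwarz-equality)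

𝟙 : Bool → ℕ
𝟙 true  = 1
𝟙 false = 0

𝟙-∧ : ∀ a b → 𝟙 (a ∧ b) ≡ 𝟙 a * 𝟙 b
𝟙-∧ true  b = sym (+-identityʳ (𝟙 b))
𝟙-∧ false b = refl

countB≡∑ : {A : Set} (p : A → Bool) (xs : List A) → countB p xs ≡ ∑[ x ∈ xs ] 𝟙 (p x)
countB≡∑ p []       = refl
countB≡∑ p (x ∷ xs) with p x
... | true  = cong suc (countB≡∑ p xs)
... | false = countB≡∑ p xs

countB-cong : {A : Set} {p q : A → Bool} (xs : List A) → (∀ x → p x ≡ q x) → countB p xs ≡ countB q xs
countB-cong {p = p} {q} xs e =
  trans (countB≡∑ p xs) (trans (∑-cong xs (λ x → cong 𝟙 (e x))) (sym (countB≡∑ q xs)))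

countB-false : {A : Set} {p : A → Bool} (xs : List A) → (∀ x → p x ≡ false) → countB p xs ≡ 0
countB-false {p = p} xs e = trans (countB≡∑ p xs) (∑-zero xs (λ x → cong 𝟙 (e x)))

sum-map-filter≡∑ : {A : Set} {P : A → Set} (P? : ∀ x → Dec (P x)) (g : A → ℕ) (xs : List A) →
                   sum (map g (filter P? xs)) ≡ ∑[ x ∈ xs ] (𝟙 ⌊ P? x ⌋ * g x)
sum-map-filter≡∑ P? g []       = refl
sum-map-filter≡∑ P? g (x ∷ xs) with P? x
... | yes _ = cong₂ _+_ (sym (+-identityʳ (g x))) (sum-map-filter≡∑ P? g xs)
... | no  _ = sum-map-filter≡∑ P? g xs

∈-subsets : ∀ {n} (S : Subset n) → S ∈ subsets n
∈-subsets []            = here refl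
∈-subsets (outside ∷ S) = ∈-++⁺ˡ (∈-map⁺ (outside ∷_) (∈-subsets S))
∈-subsets (inside  ∷ S) = ∈-++⁺ʳ (map (outside ∷_) (subsets _)) (∈-map⁺ (inside ∷_) (∈-subsets S))

∑-subsets-suc : ∀ n (f : Subset (suc n) → ℕ) →
  ∑ (subsets (suc n)) f ≡ ∑[ T ∈ subsets n ] f (outside ∷ T) + ∑[ T ∈ subsets n ] f (inside ∷ T)
∑-subsets-suc n f = trans (∑-++ (map (outside ∷_) (subsets n)) _ f)
                          (cong₂ _+_ (∑-map (subsets n) _ f) (∑-map (subsets n) _ f))

countB-subsets-suc : ∀ n (p : Subset (suc n) → Bool) →
  countB p (subsets (suc n)) ≡ countB (λ T → p (outside ∷ T)) (subsets n) + countB (λ T → p (inside ∷ T)) (subsets n)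
countB-subsets-suc n p = begin
  countB p (subsets (suc n))                          ≡⟨ countB≡∑ p (subsets (suc n)) ⟩
  ∑[ S ∈ subsets (suc n) ] 𝟙 (p S)                    ≡⟨ ∑-subsets-suc n _ ⟩
  ∑[ T ∈ subsets n ] 𝟙 (p (outside ∷ T)) + ∑[ T ∈ subsets n ] 𝟙 (p (inside ∷ T))
    ≡⟨ cong₂ _+_ (countB≡∑ _ (subsets n)) (countB≡∑ _ (subsets n)) ⟨
  countB (λ T → p (outside ∷ T)) (subsets n) + countB (λ T → p (inside ∷ T)) (subsets n) ∎

length-allFin : ∀ n → length (allFin n) ≡ n
length-allFin n = length-tabulate id

∑-allFin-suc : ∀ n (f : Fin (suc n) → ℕ) → ∑ (allFin (suc n)) f ≡ f zero + ∑[ v ∈ allFin n ] f (suc v)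
∑-allFin-suc n f = cong (f zero +_) (trans (cong (λ vs → ∑ vs f) (sym (map-tabulate id suc)))
                                           (∑-map (allFin n) suc f))

∈?-suc : ∀ {n} (v : Fin n) x (S : Subset n) → ⌊ suc v ∈? x ∷ S ⌋ ≡ ⌊ v ∈? S ⌋
∈?-suc v x S with v ∈? S
... | yes _ = refl
... | no  _ = refl

∑-𝟙-∈≡∣p∣ : ∀ {n} (S : Subset n) → ∑[ v ∈ allFin n ] 𝟙 ⌊ v ∈? S ⌋ ≡ ∣ S ∣
∑-𝟙-∈≡∣p∣ []            = refl
∑-𝟙-∈≡∣p∣ {suc n} (x ∷ S) = begin
  ∑[ v ∈ allFin (suc n) ] 𝟙 ⌊ v ∈? x ∷ S ⌋                    ≡⟨ ∑-allFin-suc n _ ⟩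
  𝟙 ⌊ zero ∈? x ∷ S ⌋ + ∑[ v ∈ allFin n ] 𝟙 ⌊ suc v ∈? x ∷ S ⌋
    ≡⟨ cong (𝟙 ⌊ zero ∈? x ∷ S ⌋ +_) (∑-cong (allFin n) (λ v → cong 𝟙 (∈?-suc v x S))) ⟩
  𝟙 ⌊ zero ∈? x ∷ S ⌋ + ∑[ v ∈ allFin n ] 𝟙 ⌊ v ∈? S ⌋        ≡⟨ cong (𝟙 ⌊ zero ∈? x ∷ S ⌋ +_) (∑-𝟙-∈≡∣p∣ S) ⟩
  𝟙 ⌊ zero ∈? x ∷ S ⌋ + ∣ S ∣                                ≡⟨ head x ⟩
  ∣ x ∷ S ∣                                                   ∎
  where
  head : ∀ x → 𝟙 ⌊ zero ∈? x ∷ S ⌋ + ∣ S ∣ ≡ ∣ x ∷ S ∣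
  head inside  = refl
  head outside = refl

module _ {n : ℕ} where

  size≡∑ : (H : Hypergraph n) → size H ≡ ∑[ S ∈ subsets n ] 𝟙 (H S)
  size≡∑ H = countB≡∑ H (subsets n)

  deg≡∑ : (H : Hypergraph n) (v : Fin n) → deg H v ≡ ∑[ S ∈ subsets n ] (𝟙 (H S) * 𝟙 ⌊ v ∈? S ⌋)
  deg≡∑ H v = trans (countB≡∑ _ (subsets n)) (∑-cong (subsets n) (λ S → 𝟙-∧ (H S) _))

  degSet≡∑ : (H : Hypergraph n) (S : Subset n) → degSet H S ≡ ∑[ v ∈ allFin n ] (𝟙 ⌊ v ∈? S ⌋ * deg H v)
  degSet≡∑ H S = sum-map-filter≡∑ (_∈? S) (deg H) (allFin n)

  double-counting : (H : Hypergraph n) (f : Fin n → ℕ) →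
    ∑[ S ∈ subsets n ] (𝟙 (H S) * ∑[ v ∈ allFin n ] (𝟙 ⌊ v ∈? S ⌋ * f v)) ≡ ∑[ v ∈ allFin n ] (deg H v * f v)
  double-counting H f = begin
    ∑[ S ∈ subsets n ] (𝟙 (H S) * ∑[ v ∈ allFin n ] (𝟙 ⌊ v ∈? S ⌋ * f v))
      ≡⟨ ∑-cong (subsets n) (λ S → ∑-distribˡ-* (allFin n) (𝟙 (H S)) _) ⟨
    ∑[ S ∈ subsets n ] ∑[ v ∈ allFin n ] (𝟙 (H S) * (𝟙 ⌊ v ∈? S ⌋ * f v))
      ≡⟨ ∑-swap (subsets n) (allFin n) _ ⟩
    ∑[ v ∈ allFin n ] ∑[ S ∈ subsets n ] (𝟙 (H S) * (𝟙 ⌊ v ∈? S ⌋ * f v))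
      ≡⟨ ∑-cong (allFin n) (λ v → ∑-cong (subsets n) (λ S → *-assoc (𝟙 (H S)) _ (f v))) ⟨
    ∑[ v ∈ allFin n ] ∑[ S ∈ subsets n ] (𝟙 (H S) * 𝟙 ⌊ v ∈? S ⌋ * f v)
      ≡⟨ ∑-cong (allFin n) (λ v → ∑-distribʳ-* (subsets n) (f v) _) ⟩
    ∑[ v ∈ allFin n ] (∑[ S ∈ subsets n ] (𝟙 (H S) * 𝟙 ⌊ v ∈? S ⌋) * f v)
      ≡⟨ ∑-cong (allFin n) (λ v → cong (_* f v) (deg≡∑ H v)) ⟨
    ∑[ v ∈ allFin n ] (deg H v * f v) ∎

  ∑-deg≡∑-edges-size : (H : Hypergraph n) → ∑[ v ∈ allFin n ] deg H v ≡ ∑[ S ∈ subsets n ] (𝟙 (H S) * ∣ S ∣)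
  ∑-deg≡∑-edges-size H = begin
    ∑[ v ∈ allFin n ] deg H v                                         ≡⟨ ∑-cong (allFin n) (λ v → *-identityʳ (deg H v)) ⟨
    ∑[ v ∈ allFin n ] (deg H v * 1)                                   ≡⟨ double-counting H (λ _ → 1) ⟨
    ∑[ S ∈ subsets n ] (𝟙 (H S) * ∑[ v ∈ allFin n ] (𝟙 ⌊ v ∈? S ⌋ * 1)) ≡⟨ ∑-cong (subsets n) (λ S → cong (𝟙 (H S) *_) (size-of S)) ⟩
    ∑[ S ∈ subsets n ] (𝟙 (H S) * ∣ S ∣)                              ∎
    where
    size-of : ∀ S → ∑[ v ∈ allFin n ] (𝟙 ⌊ v ∈? S ⌋ * 1) ≡ ∣ S ∣
    size-of S = trans (∑-cong (allFin n) (λ v → *-identityʳ _)) (∑-𝟙-∈≡∣p∣ S)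

  ∑-edges-degSet : (G H : Hypergraph n) →
    ∑[ S ∈ subsets n ] (𝟙 (G S) * degSet H S) ≡ ∑[ v ∈ allFin n ] (deg G v * deg H v)
  ∑-edges-degSet G H =
    trans (∑-cong (subsets n) (λ S → cong (𝟙 (G S) *_) (degSet≡∑ H S))) (double-counting G (deg H))

  uniform⇒∑-edges-size : ∀ {r} {H : Hypergraph n} → Uniform r H →
    ∑[ S ∈ subsets n ] (𝟙 (H S) * ∣ S ∣) ≡ r * size H
  uniform⇒∑-edges-size {r} {H} uniform = begin
    ∑[ S ∈ subsets n ] (𝟙 (H S) * ∣ S ∣)  ≡⟨ ∑-cong (subsets n) edge-size ⟩
    ∑[ S ∈ subsets n ] (r * 𝟙 (H S))      ≡⟨ ∑-distribˡ-* (subsets n) r _ ⟩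
    r * ∑[ S ∈ subsets n ] 𝟙 (H S)        ≡⟨ cong (r *_) (size≡∑ H) ⟨
    r * size H                            ∎
    where
    edge-size : ∀ S → 𝟙 (H S) * ∣ S ∣ ≡ r * 𝟙 (H S)
    edge-size S with H S in S∈H
    ... | true  = trans (+-identityʳ ∣ S ∣) (trans (uniform S S∈H) (sym (*-identityʳ r)))
    ... | false = sym (*-zeroʳ r)

  handshake : ∀ {r} {H : Hypergraph n} → Uniform r H → ∑[ v ∈ allFin n ] deg H v ≡ r * size H
  handshake {H = H} uniform = trans (∑-deg≡∑-edges-size H) (uniform⇒∑-edges-size uniform)

deg-zero : ∀ {n} (H : Hypergraph (suc n)) → deg H zero ≡ size (λ T → H (inside ∷ T))
deg-zero {n} H = begin
  deg H zero
    ≡⟨ countB-subsets-suc n _ ⟩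
  countB (λ T → H (outside ∷ T) ∧ false) (subsets n) + countB (λ T → H (inside ∷ T) ∧ true) (subsets n)
    ≡⟨ cong₂ _+_ (countB-false (subsets n) (λ T → ∧-zeroʳ _)) (countB-cong (subsets n) (λ T → ∧-identityʳ _)) ⟩
  size (λ T → H (inside ∷ T)) ∎

deg-suc : ∀ {n} (H : Hypergraph (suc n)) (w : Fin n) →
          deg H (suc w) ≡ deg (λ T → H (outside ∷ T)) w + deg (λ T → H (inside ∷ T)) w
deg-suc {n} H w = trans (countB-subsets-suc n _) (cong₂ _+_ (drop-head outside) (drop-head inside))
  where
  drop-head : ∀ x → countB (λ T → H (x ∷ T) ∧ ⌊ suc w ∈? x ∷ T ⌋) (subsets n) ≡ deg (λ T → H (x ∷ T)) w
  drop-head x = countB-cong (subsets n) (λ T → cong (H (x ∷ T) ∧_) (∈?-suc w x T))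

-- Via _≡ᵇ_ (rather than ⌊ _≟_ ⌋) so that complete (suc k) (inside ∷ T) reduces to complete k T.
complete : ∀ {n} → ℕ → Hypergraph n
complete k S = ∣ S ∣ ≡ᵇ k

complete⇒∣p∣≡k : ∀ {n k} {S : Subset n} → IsEdge (complete k) S → ∣ S ∣ ≡ k
complete⇒∣p∣≡k S∈K = ≡ᵇ⇒≡ _ _ (Equivalence.from T-≡ S∈K)

∣p∣≡k⇒complete : ∀ {n k} {S : Subset n} → ∣ S ∣ ≡ k → IsEdge (complete k) S
∣p∣≡k⇒complete ∣S∣≡k = Equivalence.to T-≡ (≡⇒≡ᵇ _ _ ∣S∣≡k)

deg-complete-zero : ∀ {n} (v : Fin n) → deg (complete 0) v ≡ 0
deg-complete-zero {n} v = countB-false (subsets n) empty-∌-v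
  where
  empty-∌-v : ∀ S → complete 0 S ∧ ⌊ v ∈? S ⌋ ≡ false
  empty-∌-v S with v ∈? S | complete 0 S in S∈K
  ... | no  _   | _     = ∧-zeroʳ _
  ... | yes _   | false = refl
  ... | yes v∈S | true  = contradiction (complete⇒∣p∣≡k {S = S} S∈K) (m<n⇒n≢0 (x∈p⇒∣p-x∣<∣p∣ v∈S))

deg-complete-suc : ∀ {n} k (v : Fin (suc n)) → deg (complete (suc k)) v ≡ size (complete {n} k)
deg-complete-suc {n} k zero = deg-zero {n} (complete (suc k))
deg-complete-suc {suc n} zero (suc w) = begin
  deg (complete 1) (suc w)                                         ≡⟨ deg-suc (complete 1) w ⟩
  deg (complete 1) w + deg (complete 0) w                          ≡⟨ cong₂ _+_ (deg-complete-suc 0 w) (deg-complete-zero w) ⟩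
  size (complete {n} 0) + 0                                        ≡⟨ cong (size (complete {n} 0) +_) (countB-false (subsets n) (λ _ → refl)) ⟨
  size (complete {n} 0) + size {n} (λ T → complete 0 (inside ∷ T)) ≡⟨ countB-subsets-suc n (complete 0) ⟨
  size (complete {suc n} 0)                                        ∎
deg-complete-suc {suc n} (suc k) (suc w) = begin
  deg (complete (2 + k)) (suc w)                       ≡⟨ deg-suc (complete (2 + k)) w ⟩
  deg (complete (2 + k)) w + deg (complete (suc k)) w  ≡⟨ cong₂ _+_ (deg-complete-suc (suc k) w) (deg-complete-suc k w) ⟩
  size (complete {n} (suc k)) + size (complete {n} k)  ≡⟨ countB-subsets-suc n (complete (suc k)) ⟨
  size (complete {suc n} (suc k))                      ∎

complete-regular : ∀ {n} k → Regular (complete {n} k)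
complete-regular         zero    u v = trans (deg-complete-zero u) (sym (deg-complete-zero v))
complete-regular {suc n} (suc k) u v = trans (deg-complete-suc k u) (sym (deg-complete-suc k v))

nonEdges : ∀ {n} → ℕ → Hypergraph n → Hypergraph n
nonEdges r H S = complete r S ∧ not (H S)

nonEdges-uniform : ∀ {n r} (H : Hypergraph n) → Uniform r (nonEdges r H)
nonEdges-uniform {r = r} H S S∈H̄ with complete r S in S∈K
... | true = complete⇒∣p∣≡k {S = S} S∈K

module _ {n r : ℕ} {H : Hypergraph n} (uniform : Uniform r H) where

  𝟙-complete-split : ∀ S → 𝟙 (complete r S) ≡ 𝟙 (H S) + 𝟙 (nonEdges r H S)
  𝟙-complete-split S with H S in S∈H | complete r S in S∈K
  ... | true  | true  = refl
  ... | true  | false = contradiction (trans (sym S∈K) (∣p∣≡k⇒complete {S = S} (uniform S S∈H))) λ ()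
  ... | false | true  = refl
  ... | false | false = refl

  ∑-complete-split : (w : Subset n → ℕ) →
    ∑[ S ∈ subsets n ] (𝟙 (complete r S) * w S)
      ≡ ∑[ S ∈ subsets n ] (𝟙 (H S) * w S) + ∑[ S ∈ subsets n ] (𝟙 (nonEdges r H S) * w S)
  ∑-complete-split w = trans (∑-cong (subsets n) split) (∑-distrib-+ (subsets n) _ _)
    where
    split : ∀ S → 𝟙 (complete r S) * w S ≡ 𝟙 (H S) * w S + 𝟙 (nonEdges r H S) * w S
    split S = trans (cong (_* w S) (𝟙-complete-split S)) (*-distribʳ-+ (w S) (𝟙 (H S)) _)

  ∑-deg-complete : ∑[ v ∈ allFin n ] deg (complete r) v ≡ r * size H + r * size (nonEdges r H)
  ∑-deg-complete = begin
    ∑[ v ∈ allFin n ] deg (complete r) v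
      ≡⟨ ∑-deg≡∑-edges-size (complete {n} r) ⟩
    ∑[ S ∈ subsets n ] (𝟙 (complete r S) * ∣ S ∣)
      ≡⟨ ∑-complete-split ∣_∣ ⟩
    ∑[ S ∈ subsets n ] (𝟙 (H S) * ∣ S ∣) + ∑[ S ∈ subsets n ] (𝟙 (nonEdges r H S) * ∣ S ∣)
      ≡⟨ cong₂ _+_ (uniform⇒∑-edges-size uniform) (uniform⇒∑-edges-size (nonEdges-uniform H)) ⟩
    r * size H + r * size (nonEdges r H) ∎

  ∑-deg-complete*deg : ∑[ v ∈ allFin n ] (deg (complete r) v * deg H v)
    ≡ ∑[ v ∈ allFin n ] (deg H v * deg H v) + ∑[ S ∈ subsets n ] (𝟙 (nonEdges r H S) * degSet H S)
  ∑-deg-complete*deg = begin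
    ∑[ v ∈ allFin n ] (deg (complete r) v * deg H v)
      ≡⟨ ∑-edges-degSet (complete r) H ⟨
    ∑[ S ∈ subsets n ] (𝟙 (complete r S) * degSet H S)
      ≡⟨ ∑-complete-split (degSet H) ⟩
    ∑[ S ∈ subsets n ] (𝟙 (H S) * degSet H S) + ∑[ S ∈ subsets n ] (𝟙 (nonEdges r H S) * degSet H S)
      ≡⟨ cong (_+ ∑[ S ∈ subsets n ] (𝟙 (nonEdges r H S) * degSet H S)) (∑-edges-degSet H H) ⟩
    ∑[ v ∈ allFin n ] (deg H v * deg H v) + ∑[ S ∈ subsets n ] (𝟙 (nonEdges r H S) * degSet H S) ∎

  degree-balance :
    n * ∑[ v ∈ allFin n ] (deg H v * deg H v) + n * ∑[ S ∈ subsets n ] (𝟙 (nonEdges r H S) * degSet H S)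
      ≡ (r * size H) * (r * size H) + r * r * size H * size (nonEdges r H)
  degree-balance = begin
    n * Q + n * P                                           ≡⟨ *-distribˡ-+ n Q P ⟨
    n * (Q + P)                                             ≡⟨ cong (n *_) ∑-deg-complete*deg ⟨
    n * ∑[ v ∈ allFin n ] (deg (complete r) v * deg H v)    ≡⟨ cong (_* ∑[ v ∈ allFin n ] (deg (complete r) v * deg H v)) (length-allFin n) ⟨
    length (allFin n) * ∑[ v ∈ allFin n ] (deg (complete r) v * deg H v)
      ≡⟨ constant⇒length*∑f*g≡∑f*∑g (allFin n) (deg (complete r)) (deg H) (complete-regular r) ⟩
    ∑[ v ∈ allFin n ] deg (complete r) v * ∑[ v ∈ allFin n ] deg H v
      ≡⟨ cong₂ _*_ ∑-deg-complete (handshake uniform) ⟩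
    (r * m + r * K) * (r * m)                               ≡⟨ expand r m K ⟩
    (r * m) * (r * m) + r * r * m * K                       ∎
    where
    m = size H
    K = size (nonEdges r H)
    Q = ∑[ v ∈ allFin n ] (deg H v * deg H v)
    P = ∑[ S ∈ subsets n ] (𝟙 (nonEdges r H S) * degSet H S)
    expand : ∀ r m K → (r * m + r * K) * (r * m) ≡ (r * m) * (r * m) + r * r * m * K
    expand = solve-∀

module _ {n r s : ℕ} {H : Hypergraph n} (ore : IsOreDegree r H s) where

  ore-degree-bound : s * size (nonEdges r H) ≤ ∑[ S ∈ subsets n ] (𝟙 (nonEdges r H S) * degSet H S)
  ore-degree-bound = ≤-trans (≤-reflexive s*count≡∑) (∑-mono-≤ (subsets n) pointwise)
    where
    s*count≡∑ : s * size (nonEdges r H) ≡ ∑[ S ∈ subsets n ] (s * 𝟙 (nonEdges r H S))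
    s*count≡∑ = trans (cong (s *_) (size≡∑ (nonEdges r H))) (sym (∑-distribˡ-* (subsets n) s _))
    pointwise : ∀ S → s * 𝟙 (nonEdges r H S) ≤ 𝟙 (nonEdges r H S) * degSet H S
    pointwise S with H S in S∉H | complete r S in S∈K
    ... | false | true  = subst₂ _≤_ (sym (*-identityʳ s)) (sym (+-identityʳ _))
                                 (proj₂ ore S (complete⇒∣p∣≡k {S = S} S∈K) S∉H)
    ... | false | false = ≤-reflexive (*-zeroʳ s)
    ... | true  | true  = ≤-reflexive (*-zeroʳ s)
    ... | true  | false = ≤-reflexive (*-zeroʳ s)

  nonEdges-nonempty : 1 ≤ size (nonEdges r H)
  nonEdges-nonempty with proj₁ ore
  ... | S₀ , ∣S₀∣≡r , S₀∉H , _ =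
    ≤-trans (≤-reflexive S₀∈H̄) (≤-trans (∈⇒≤∑ (λ S → 𝟙 (nonEdges r H S)) (∈-subsets S₀))
                                       (≤-reflexive (sym (size≡∑ (nonEdges r H)))))
    where
    S₀∈H̄ : 1 ≡ 𝟙 (nonEdges r H S₀)
    S₀∈H̄ = sym (cong₂ (λ a b → 𝟙 (a ∧ not b)) (∣p∣≡k⇒complete {S = S₀} ∣S₀∣≡r) S₀∉H)

m+n≡o+p∧o≤m⇒n≤p : ∀ {a b c d} → a + b ≡ c + d → c ≤ a → b ≤ d
m+n≡o+p∧o≤m⇒n≤p {a} {b} {c} {d} eq c≤a = +-cancelˡ-≤ c b d (≤-trans (+-monoˡ-≤ b c≤a) (≤-reflexive eq))

squeeze : ∀ {a b c e x k} .{{_ : NonZero k}} → a + b ≡ c + e * k → c ≤ a → x * k ≤ b →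
          x ≤ e × (x ≡ e → a ≡ c)
squeeze {a} {b} {c} {e} {x} {k} eq c≤a xk≤b = x≤e , x≡e⇒a≡c
  where
  b≤ek : b ≤ e * k
  b≤ek = m+n≡o+p∧o≤m⇒n≤p eq c≤a
  x≤e : x ≤ e
  x≤e = *-cancelʳ-≤ x e k (≤-trans xk≤b b≤ek)
  x≡e⇒a≡c : x ≡ e → a ≡ c
  x≡e⇒a≡c x≡e = +-cancelʳ-≡ b a c (trans eq (cong (c +_) (sym b≡ek)))
    where b≡ek = ≤-antisym b≤ek (subst (λ t → t * k ≤ b) x≡e xk≤b)

lemma2p2 : ∀ {n r : ℕ} (H : Hypergraph n) → 1 ≤ r → Uniform r H →
    ∀ s → IsOreDegree r H s →
    (n * s ≤ r * r * size H) × (n * s ≡ r * r * size H → Regular H)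
lemma2p2 {n} {r} H _ uniform s ore =
  map₂ (λ x≡e⇒a≡c n*s≡r²m u v → equal-degrees (x≡e⇒a≡c n*s≡r²m) (∈-allFin u) (∈-allFin v))
       (squeeze {{>-nonZero (nonEdges-nonempty ore)}} (degree-balance uniform) cauchy-schwarz-deg n*s*K≤n*P)
  where
  Q = ∑[ v ∈ allFin n ] (deg H v * deg H v)
  P = ∑[ S ∈ subsets n ] (𝟙 (nonEdges r H S) * degSet H S)
  ∑deg≡rm = handshake uniform

  cauchy-schwarz-deg : (r * size H) * (r * size H) ≤ n * Q
  cauchy-schwarz-deg = subst₂ (λ D L → D * D ≤ L * Q) ∑deg≡rm (length-allFin n) (cauchy-schwarz (allFin n) (deg H))

  n*s*K≤n*P : n * s * size (nonEdges r H) ≤ n * P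
  n*s*K≤n*P = subst (_≤ n * P) (sym (*-assoc n s _)) (*-monoʳ-≤ n (ore-degree-bound ore))

  equal-degrees : n * Q ≡ (r * size H) * (r * size H) → ∀ {u v} → u ∈ allFin n → v ∈ allFin n → deg H u ≡ deg H v
  equal-degrees eq = cauchy-schwarz-equality (allFin n) (deg H)
    (subst₂ (λ L D → L * Q ≡ D * D) (sym (length-allFin n)) (sym ∑deg≡rm) eq)
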